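{- Up to isomorphism, the only $Tr_2^{(v,e)}$-critical graph is $K_2$; that is, a graph $G$ is transitively vertex-edge critical with $Tr(G)=2$ if and only if $G\cong K_2$.
   Context: All graphs are finite and simple. For disjoint $A,B\subseteq V$, $A$ dominates $B$ if every vertex of $B$ is adjacent to at least one vertex of $A$. A transitive $k$-partition of $G=(V,E)$ is a partition $\{V_1,\dots,V_k\}$ of $V$ into $k$ nonempty parts such that $V_i$ dominates $V_j$ for all $1\le i<j\le k$; the transitivity $Tr(G)$ is the maximum such $k$. A graph $G=(V,E)$ is transitively vertex-edge critical if deleting any element of $V\cup E$ (deleting a vertex removes it together with its incident edges) yields a graph of transitivity less than $Tr(G)$; such a graph with $Tr(G)=k$ is called $Tr_k^{(v,e)}$-critical. -}

module Defs where

open import Data.Nat using (ℕ; zero; suc; _<_; _≤_)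
open import Data.Fin using (Fin; zero; suc; punchIn; _≟_)
open import Data.Bool using (Bool; true; false; _∧_; _∨_; not)
open import Data.Bool.Properties using (∨-comm)
open import Data.Product using (Σ; _×_; _,_; ∃)
open import Relation.Nullary.Decidable using (⌊_⌋)
open import Relation.Binary.PropositionalEquality using (_≡_; refl; cong)
open import Function.Bundles using (Bijection)
open import Function.Base using (_∘_)
open import Relation.Binary.PropositionalEquality using (setoid)

record Graph (n : ℕ) : Set where
  field
    adj    : Fin n → Fin n → Bool
    sym    : ∀ x y → adj x y ≡ adj y x
    irrefl : ∀ x → adj x x ≡ false
open Graph public

record TransPartition {n : ℕ} (G : Graph n) (k : ℕ) : Set where
  field
    part     : Fin n → Fin k
    nonempty : ∀ (i : Fin k) → ∃ λ v → part v ≡ i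
    dominate : ∀ (i j : Fin k) → Data.Fin._<_ i j →
               ∀ v → part v ≡ j → ∃ λ u → part u ≡ i × adj G u v ≡ true

IsTransitivity : ∀ {n} → Graph n → ℕ → Set
IsTransitivity G k = TransPartition G k × (∀ m → TransPartition G m → m ≤ k)

TrLess : ∀ {n} → Graph n → ℕ → Set
TrLess G k = ∀ m → TransPartition G m → m < k

deleteVertex : ∀ {n} → Graph (suc n) → Fin (suc n) → Graph n
deleteVertex G v = record
  { adj    = λ x y → adj G (punchIn v x) (punchIn v y)
  ; sym    = λ x y → sym G (punchIn v x) (punchIn v y)
  ; irrefl = λ x → irrefl G (punchIn v x)
  }

private
  isPair : ∀ {n} → Fin n → Fin n → Fin n → Fin n → Bool
  isPair u v x y = ⌊ x ≟ u ⌋ ∧ ⌊ y ≟ v ⌋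

deleteEdge : ∀ {n} → Graph n → Fin n → Fin n → Graph n
deleteEdge G u v = record
  { adj    = λ x y → adj G x y ∧ not (isPair u v x y ∨ isPair u v y x)
  ; sym    = λ x y → cong₂∧ (sym G x y) (cong not (∨-comm (isPair u v x y) (isPair u v y x)))
  ; irrefl = λ x → cong (λ b → b ∧ not (isPair u v x x ∨ isPair u v x x)) (irrefl G x)
  }
  where
  cong₂∧ : ∀ {a b c d} → a ≡ b → c ≡ d → a ∧ c ≡ b ∧ d
  cong₂∧ refl refl = refl

-- Transitively vertex-edge critical with Tr(G) = k (Tr_k^{(v,e)}-critical).
-- Vertex deletion only makes sense when there is a vertex, hence the case
-- split on n.
VertexCritical : ∀ {n} → Graph n → ℕ → Set
VertexCritical {zero}  G k = Data.Unit.⊤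
  where import Data.Unit
VertexCritical {suc n} G k = ∀ v → TrLess (deleteVertex G v) k

EdgeCritical : ∀ {n} → Graph n → ℕ → Set
EdgeCritical G k = ∀ u v → adj G u v ≡ true → TrLess (deleteEdge G u v) k

TrCritical : ∀ {n} → Graph n → ℕ → Set
TrCritical G k = IsTransitivity G k × VertexCritical G k × EdgeCritical G k

record Iso {n m : ℕ} (G : Graph n) (H : Graph m) : Set where
  field
    f        : Bijection (setoid (Fin n)) (setoid (Fin m))
    preserve : ∀ x y → adj G x y ≡ adj H (Bijection.to f x) (Bijection.to f y)

K₂ : Graph 2
K₂ = record { adj = a ; sym = s ; irrefl = i }
  where
  a : Fin 2 → Fin 2 → Bool
  a zero zero = false
  a zero (suc zero) = true
  a (suc zero) zero = true
  a (suc zero) (suc zero) = false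
  s : ∀ x y → a x y ≡ a y x
  s zero zero = refl
  s zero (suc zero) = refl
  s (suc zero) zero = refl
  s (suc zero) (suc zero) = refl
  i : ∀ x → a x x ≡ false
  i zero = refl
  i (suc zero) = refl

{-# OPTIONS --safe #-}
-- A graph has a transitive partition into at least two parts exactly when it has an edge uv,
-- witnessed by the partition (V - v, {v}); and no partition has more parts than there are
-- vertices. So a Tr₂-critical graph has an edge, and deleting any third vertex would keep
-- that edge and hence transitivity 2: the graph is K₂. Conversely, in K₂ deleting a vertex
-- leaves one vertex and deleting the edge leaves no edge, so transitivity drops below 2.
module Submission where

open import Defs
open import Data.Nat using (ℕ; zero; suc; _≤_; s≤s; z≤n)
open import Data.Nat.Properties using (<-irrefl)
open import Data.Fin using (Fin; zero; suc; punchOut; _≟_)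
open import Data.Fin.Properties using (injective⇒≤; punchIn-punchOut; cantor-schröder-bernstein)
open import Data.Bool using (true; false)
open import Data.Bool.Properties using (∧-zeroʳ)
open import Data.Product using (_×_; _,_; ∃; ∃₂; proj₁; proj₂)
open import Data.Empty using (⊥-elim)
open import Relation.Nullary using (yes; no; contradiction)
open import Relation.Binary.PropositionalEquality
  using (_≡_; _≢_; refl; trans; cong; subst₂; setoid) renaming (sym to ≡-sym)
open import Function.Bundles using (_⇔_; mk⇔; Bijection)
open import Function.Construct.Identity using (bijection)
open import Function.Properties.Bijection using (sym-≡)

adj⇒≢ : ∀ {n} (G : Graph n) {u v} → adj G u v ≡ true → u ≢ v
adj⇒≢ G {u} e refl = contradiction (trans (≡-sym e) (irrefl G u)) λ ()

deleteVertex-adj : ∀ {n} (G : Graph (suc n)) {u v w} (w≢u : w ≢ u) (w≢v : w ≢ v) →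
                   adj G u v ≡ true → adj (deleteVertex G w) (punchOut w≢u) (punchOut w≢v) ≡ true
deleteVertex-adj G w≢u w≢v =
  subst₂ (λ x y → adj G x y ≡ true) (≡-sym (punchIn-punchOut w≢u)) (≡-sym (punchIn-punchOut w≢v))

deleteEdge-removes : ∀ {n} (G : Graph n) u v → adj (deleteEdge G u v) u v ≡ false
deleteEdge-removes G u v with u ≟ u | v ≟ v
... | yes _   | yes _   = ∧-zeroʳ (adj G u v)
... | no u≢u  | _       = contradiction refl u≢u
... | yes _   | no v≢v  = contradiction refl v≢v

transPartition⇒≤ : ∀ {n m} {G : Graph n} → TransPartition G m → m ≤ n
transPartition⇒≤ P = injective⇒≤ {f = representative} representative-injective
  where
  open TransPartition P
  representative : Fin _ → Fin _
  representative i = proj₁ (nonempty i)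
  representative-injective : ∀ {i j} → representative i ≡ representative j → i ≡ j
  representative-injective {i} {j} eq =
    trans (≡-sym (proj₂ (nonempty i))) (trans (cong part eq) (proj₂ (nonempty j)))

transPartition⇒edge : ∀ {n m} {G : Graph n} → TransPartition G (suc (suc m)) →
                      ∃₂ λ u v → adj G u v ≡ true
transPartition⇒edge P =
  let v , v∈V₁ = nonempty (suc zero)
      u , _ , uv = dominate zero (suc zero) (s≤s z≤n) v v∈V₁
  in u , v , uv
  where open TransPartition P

edge⇒transPartition₂ : ∀ {n} (G : Graph n) {u v} → adj G u v ≡ true → TransPartition G 2
edge⇒transPartition₂ G {u} {v} uv = record
  { part = part ; nonempty = nonempty ; dominate = dominate }
  where
  part : Fin _ → Fin 2
  part x with x ≟ v
  ... | yes _ = suc zero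
  ... | no _  = zero
  part-u : part u ≡ zero
  part-u with u ≟ v
  ... | yes u≡v = contradiction u≡v (adj⇒≢ G uv)
  ... | no _    = refl
  part-v : part v ≡ suc zero
  part-v with v ≟ v
  ... | yes _   = refl
  ... | no v≢v  = contradiction refl v≢v
  part≡1⇒≡v : ∀ {x} → part x ≡ suc zero → x ≡ v
  part≡1⇒≡v {x} p with x ≟ v
  part≡1⇒≡v     _  | yes x≡v = x≡v
  part≡1⇒≡v     () | no _
  nonempty : ∀ i → ∃ λ x → part x ≡ i
  nonempty zero       = u , part-u
  nonempty (suc zero) = v , part-v
  dominate : ∀ i j → Data.Fin._<_ i j → ∀ x → part x ≡ j →
             ∃ λ y → part y ≡ i × adj G y x ≡ true
  dominate zero       (suc zero) _ x px with part≡1⇒≡v px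
  ... | refl = u , part-u , uv
  dominate (suc zero) (suc zero) (s≤s ())

edgeless⇒TrLess₂ : ∀ {n} (G : Graph n) → (∀ u v → adj G u v ≢ true) → TrLess G 2
edgeless⇒TrLess₂ G edgeless zero             P = s≤s z≤n
edgeless⇒TrLess₂ G edgeless (suc zero)       P = s≤s (s≤s z≤n)
edgeless⇒TrLess₂ G edgeless (suc (suc m))    P =
  let u , v , uv = transPartition⇒edge P in contradiction uv (edgeless u v)

avoid₂ : ∀ {k} (a b : Fin (suc (suc (suc k)))) → ∃ λ w → w ≢ a × w ≢ b
avoid₂ zero             zero             = suc zero , (λ ()) , (λ ())
avoid₂ zero             (suc zero)       = suc (suc zero) , (λ ()) , (λ ())
avoid₂ zero             (suc (suc _))    = suc zero , (λ ()) , (λ ())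
avoid₂ (suc zero)       zero             = suc (suc zero) , (λ ()) , (λ ())
avoid₂ (suc zero)       (suc _)          = zero , (λ ()) , (λ ())
avoid₂ (suc (suc _))    zero             = suc zero , (λ ()) , (λ ())
avoid₂ (suc (suc _))    (suc _)          = zero , (λ ()) , (λ ())

K₂-adj : ∀ {x y} → x ≢ y → adj K₂ x y ≡ true
K₂-adj {zero}     {zero}     x≢y = contradiction refl x≢y
K₂-adj {zero}     {suc zero} _   = refl
K₂-adj {suc zero} {zero}     _   = refl
K₂-adj {suc zero} {suc zero} x≢y = contradiction refl x≢y

edge⇒adj₀₁ : (G : Graph 2) {u v : Fin 2} → adj G u v ≡ true → adj G zero (suc zero) ≡ true
edge⇒adj₀₁ G {zero}     {zero}     uv = contradiction refl (adj⇒≢ G uv)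
edge⇒adj₀₁ G {zero}     {suc zero} uv = uv
edge⇒adj₀₁ G {suc zero} {zero}     uv = trans (sym G zero (suc zero)) uv
edge⇒adj₀₁ G {suc zero} {suc zero} uv = contradiction refl (adj⇒≢ G uv)

edge⇒adj≗K₂ : (G : Graph 2) {u v : Fin 2} → adj G u v ≡ true → ∀ x y → adj G x y ≡ adj K₂ x y
edge⇒adj≗K₂ G uv zero       zero       = irrefl G zero
edge⇒adj≗K₂ G uv zero       (suc zero) = edge⇒adj₀₁ G uv
edge⇒adj≗K₂ G uv (suc zero) zero       = trans (sym G (suc zero) zero) (edge⇒adj₀₁ G uv)
edge⇒adj≗K₂ G uv (suc zero) (suc zero) = irrefl G (suc zero)

edge⇒Iso-K₂ : (G : Graph 2) {u v : Fin 2} → adj G u v ≡ true → Iso G K₂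
edge⇒Iso-K₂ G uv = record { f = bijection (setoid (Fin 2)) ; preserve = edge⇒adj≗K₂ G uv }

deleteEdge-edgeless₂ : (G : Graph 2) {u v : Fin 2} → adj G u v ≡ true →
                       ∀ x y → adj (deleteEdge G u v) x y ≢ true
deleteEdge-edgeless₂ G {u} {v} uv x y xy =
  contradiction (trans (≡-sym (deleteEdge-removes G u v))
                       (trans (edge⇒adj≗K₂ (deleteEdge G u v) xy u v) (K₂-adj (adj⇒≢ G uv))))
                λ ()

edge⇒TrCritical₂ : (G : Graph 2) {u v : Fin 2} → adj G u v ≡ true → TrCritical G 2
edge⇒TrCritical₂ G uv =
    (edge⇒transPartition₂ G uv , λ _ P → transPartition⇒≤ P)
  , (λ _ _ P → s≤s (transPartition⇒≤ P))
  , (λ _ _ u'v' → edgeless⇒TrLess₂ _ (deleteEdge-edgeless₂ G u'v'))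

edge∧VertexCritical₂⇒Iso-K₂ : ∀ {n} (G : Graph n) {u v} → adj G u v ≡ true →
                               VertexCritical G 2 → Iso G K₂
edge∧VertexCritical₂⇒Iso-K₂ {suc zero} G {zero} {zero} uv _ = contradiction refl (adj⇒≢ G uv)
edge∧VertexCritical₂⇒Iso-K₂ {suc (suc zero)} G uv _ = edge⇒Iso-K₂ G uv
edge∧VertexCritical₂⇒Iso-K₂ {suc (suc (suc _))} G {u} {v} uv critical =
  let w , w≢u , w≢v = avoid₂ u v
  in ⊥-elim (<-irrefl refl
       (critical w 2 (edge⇒transPartition₂ _ (deleteVertex-adj G w≢u w≢v uv))))

TrCritical₂⇒Iso-K₂ : ∀ {n} (G : Graph n) → TrCritical G 2 → Iso G K₂
TrCritical₂⇒Iso-K₂ G ((P , _) , vertexCritical , _) =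
  let u , v , uv = transPartition⇒edge P in edge∧VertexCritical₂⇒Iso-K₂ G uv vertexCritical

Bijection-Fin⇒≡ : ∀ {m n} → Bijection (setoid (Fin m)) (setoid (Fin n)) → m ≡ n
Bijection-Fin⇒≡ f = cantor-schröder-bernstein (Bijection.injective f) (Bijection.injective (sym-≡ f))

Iso-K₂⇒TrCritical₂ : ∀ {n} (G : Graph n) → Iso G K₂ → TrCritical G 2
Iso-K₂⇒TrCritical₂ G iso with Bijection-Fin⇒≡ (Iso.f iso)
... | refl = edge⇒TrCritical₂ G (trans (preserve zero (suc zero)) (K₂-adj to0≢to1))
  where
  open Iso iso
  to0≢to1 : Bijection.to f zero ≢ Bijection.to f (suc zero)
  to0≢to1 eq = contradiction (Bijection.injective f eq) λ ()

proposition1 : ∀ (n : ℕ) (G : Graph n) → TrCritical G 2 ⇔ Iso G K₂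
proposition1 n G = mk⇔ (TrCritical₂⇒Iso-K₂ G) (Iso-K₂⇒TrCritical₂ G)
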